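{- Let $P$ be a finite poset and suppose that for some $m$ there is an induced $P$-saturating family $\mathcal F\subseteq 2^{[m]}$ that is not separating, i.e., some two distinct elements of $[m]$ are not separated by $\mathcal F$ (equivalently, some atom of $\mathcal A(\mathcal F)$ is not a singleton). Then $\mathrm{sat}^*(n,P)\le|\mathcal F|$ for every $n\ge m$; in particular $\mathrm{sat}^*(n,P)=O(1)$.
   Context: A subfamily $\mathcal G\subseteq\mathcal F\subseteq 2^{[n]}$ is an induced copy of a poset $P$ if there is a bijection $i:P\to\mathcal G$ with $p\le_P q$ iff $i(p)\subseteq i(q)$. $\mathcal F$ is induced $P$-saturating if it has no induced copy of $P$ and adding any $G\in 2^{[n]}\setminus\mathcal F$ creates one. $\mathrm{sat}^*(n,P)$ is the minimum size of an induced $P$-saturating family in $2^{[n]}$. Two elements $x,y$ are separated by $\mathcal F$ if some $F\in\mathcal F$ has $|F\cap\{x,y\}|=1$. $\mathcal A(\mathcal F)$ is the Boolean algebra of subsets of the base set generated by $\mathcal F$ under union, intersection and complement; atoms are its minimal nonempty members. -}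

module Defs where

open import Level using (0ℓ)
open import Data.Nat using (ℕ; _≤_)
open import Data.Fin using (Fin)
open import Data.Fin.Subset using (Subset; _∈_; _∉_; _⊆_)
open import Data.List using (List; _∷_; length)
import Data.List.Membership.Propositional as LM
open import Data.List.Relation.Unary.Unique.Propositional using (Unique)
open import Data.Product using (Σ; ∃; _×_; _,_)
open import Data.Sum using (_⊎_)
open import Relation.Binary.PropositionalEquality using (_≡_; _≢_)
open import Relation.Binary.Structures using (IsPartialOrder)
open import Relation.Nullary using (¬_)
open import Function.Definitions using (Injective)
open import Function.Bundles using (_⇔_)

record FinPoset (k : ℕ) : Set₁ where
  field
    _≤P_ : Fin k → Fin k → Set
    isPartialOrder : IsPartialOrder _≡_ _≤P_

open FinPoset public

-- A family of subsets of [n] : a duplicate-free list of subsets of Fin n.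
Family : ℕ → Set
Family n = List (Subset n)

InducedCopy : ∀ {k n} → FinPoset k → Family n → Set
InducedCopy {k} {n} P 𝓕 =
  Σ (Fin k → Subset n) λ i →
    Injective _≡_ _≡_ i
    × (∀ p → i p LM.∈ 𝓕)
    × (∀ p q → (_≤P_ P p q ⇔ (i p ⊆ i q)))

Saturating : ∀ {k n} → FinPoset k → Family n → Set
Saturating P 𝓕 =
  ¬ InducedCopy P 𝓕
  × (∀ G → ¬ (G LM.∈ 𝓕) → InducedCopy P (G ∷ 𝓕))

Separated : ∀ {m} → Family m → Fin m → Fin m → Set
Separated 𝓕 x y =
  ∃ λ F → F LM.∈ 𝓕 × ((x ∈ F × y ∉ F) ⊎ (x ∉ F × y ∈ F))

NotSeparating : ∀ {m} → Family m → Set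
NotSeparating {m} 𝓕 = ∃ λ (x : Fin m) → ∃ λ (y : Fin m) → x ≢ y × ¬ Separated 𝓕 x y

-- sat*(n,P) ≤ c : since sat* is a minimum, this means some induced
-- P-saturating family in 2^[n] has size at most c.
SatStar≤ : ∀ {k} → ℕ → FinPoset k → ℕ → Set
SatStar≤ n P c = ∃ λ (𝒢 : Family n) → Unique 𝒢 × Saturating P 𝒢 × length 𝒢 ≤ c

-- Let x ≠ y be points of [m] not separated by 𝓕. Adding a new point 0 that copies x
-- maps 𝓕 to a family on [m+1] of the same size, in which suc x and suc y are still
-- unseparated. On the sets where x and y agree, this copying map e is an order
-- embedding with a map φ back that is at once its left and its right adjoint:
-- φ G contains x iff G meets the block {0, suc x, suc y}, and y iff G contains it.
-- Hence a set G outside e 𝓕 sits relative to e 𝓕 exactly as φ G ∉ 𝓕 sits relative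
-- to 𝓕, so both halves of induced saturation transfer; iterate from m up to n.

module Submission where

open import Defs
open import Data.Nat using (ℕ; _≤_; suc; _≤′_; ≤′-reflexive; ≤′-step)
open import Data.List using (length)
open import Data.List.Relation.Unary.Unique.Propositional using (Unique)

open import Data.Nat.Properties using (≤⇒≤′; ≤-reflexive)
open import Data.Bool using (Bool; true; false; _∧_; _∨_; b≤b)
  renaming (_≤_ to _≤ᵇ_)
open import Data.Bool.Properties using (≤-minimum; ≤-maximum)
  renaming (≤-trans to ≤ᵇ-trans; ≤-reflexive to ≤ᵇ-reflexive)
open import Data.Fin using (Fin; zero; suc; _≟_)
open import Data.Fin.Properties using (suc-injective)
open import Data.Fin.Subset using (Subset; _⊆_) renaming (_∉_ to _∉ˢ_)
open import Data.Fin.Subset.Properties using (⊆-refl; ⊆-reflexive; ⊆-antisym; drop-there)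
open import Data.Vec using (_∷_; lookup; _[_]≔_)
import Data.Vec as Vec
open import Data.Vec.Properties
  using ([]=⇒lookup; lookup⇒[]=; lookup∘update; lookup∘update′; ∷-injectiveʳ)
open import Data.List using (_∷_; map)
open import Data.List.Properties using (length-map)
open import Data.List.Membership.Propositional using (_∈_)
open import Data.List.Membership.Propositional.Properties using (∈-map⁻; ∈-map⁺)
open import Data.List.Relation.Unary.Any using (here; there)
import Data.List.Relation.Unary.Unique.Propositional.Properties as Unique
open import Data.Product using (∃; _×_; _,_; proj₁; proj₂)
import Data.Product as Product
import Data.Sum as Sum
open import Data.Sum using (inj₁; inj₂)
open import Relation.Binary.PropositionalEquality
  using (_≡_; _≢_; refl; sym; trans; subst)
open import Relation.Binary.Structures using (IsPartialOrder)
open import Relation.Nullary using (¬_; yes; no; contradiction)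
open import Function using (_∘_)
open import Function.Bundles using (_⇔_; mk⇔; Equivalence)
import Function.Properties.Equivalence as ⇔
open Equivalence using (to; from)

private
  variable
    k m n : ℕ

∨-least : ∀ {a b c} → a ≤ᵇ c → b ≤ᵇ c → a ∨ b ≤ᵇ c
∨-least {false} _   b≤c = b≤c
∨-least {true}  b≤b _   = b≤b

≤-∨ˡ : ∀ a b → a ≤ᵇ a ∨ b
≤-∨ˡ false b = ≤-minimum b
≤-∨ˡ true  b = b≤b

≤-∨ʳ : ∀ a b → b ≤ᵇ a ∨ b
≤-∨ʳ false b = b≤b
≤-∨ʳ true  b = ≤-maximum b

∧-greatest : ∀ {a b c} → c ≤ᵇ a → c ≤ᵇ b → c ≤ᵇ a ∧ b
∧-greatest {true}  _   c≤b = c≤b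
∧-greatest {false} b≤b _   = b≤b

∧-≤ˡ : ∀ a b → a ∧ b ≤ᵇ a
∧-≤ˡ false b = b≤b
∧-≤ˡ true  b = ≤-maximum b

∧-≤ʳ : ∀ a b → a ∧ b ≤ᵇ b
∧-≤ʳ false b = ≤-minimum b
∧-≤ʳ true  b = b≤b

infix 4 _⊑_

_⊑_ : Subset n → Subset n → Set
p ⊑ q = ∀ i → lookup p i ≤ᵇ lookup q i

⊆⇔⊑ : {p q : Subset n} → p ⊆ q ⇔ p ⊑ q
⊆⇔⊑ {p = p} {q} = mk⇔ ⊆⇒⊑ ⊑⇒⊆
  where
  ⊆⇒⊑ : p ⊆ q → p ⊑ q
  ⊆⇒⊑ p⊆q i with lookup p i in pᵢ
  ... | false = ≤-minimum _
  ... | true  = ≤ᵇ-reflexive (sym ([]=⇒lookup (p⊆q (lookup⇒[]= i p pᵢ))))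
  ⊑⇒⊆ : p ⊑ q → p ⊆ q
  ⊑⇒⊆ p⊑q {i} i∈p =
    lookup⇒[]= i q (true≤⇒≡true (subst (_≤ᵇ lookup q i) ([]=⇒lookup i∈p) (p⊑q i)))
    where
    true≤⇒≡true : ∀ {b} → true ≤ᵇ b → b ≡ true
    true≤⇒≡true b≤b = refl

∉-lookup : ∀ {p : Subset n} {i} → lookup p i ≡ false → i ∉ˢ p
∉-lookup pᵢ≡false i∈p with trans (sym ([]=⇒lookup i∈p)) pᵢ≡false
... | ()

⊑-⇔⇒⊆-⇔ : {p q : Subset m} {p′ q′ : Subset n} → p ⊑ q ⇔ p′ ⊑ q′ → p ⊆ q ⇔ p′ ⊆ q′
⊑-⇔⇒⊆-⇔ p⊑q⇔p′⊑q′ = ⇔.trans ⊆⇔⊑ (⇔.trans p⊑q⇔p′⊑q′ (⇔.sym ⊆⇔⊑))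

⊆-⇔-cong : {A A′ B B′ : Subset n} → A ≡ A′ → B ≡ B′ → A ⊆ B ⇔ A′ ⊆ B′
⊆-⇔-cong refl refl = ⇔.refl

inducedCopy : (P : FinPoset k) {𝓕 : Family n} (i : Fin k → Subset n) →
  (∀ p → i p ∈ 𝓕) → (∀ p q → _≤P_ P p q ⇔ i p ⊆ i q) → InducedCopy P 𝓕
inducedCopy P i i∈𝓕 order = i , injective , i∈𝓕 , order
  where
  injective : ∀ {p q} → i p ≡ i q → p ≡ q
  injective {p} {q} ip≡iq = IsPartialOrder.antisym (isPartialOrder P)
    (from (order p q) (⊆-reflexive ip≡iq)) (from (order q p) (⊆-reflexive (sym ip≡iq)))

module AdjointTransfer
  (U : Subset m → Set) (e : Subset m → Subset n) (φ : Subset n → Subset m)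
  (φ⊣e : ∀ {G F} → U F → G ⊆ e F ⇔ φ G ⊆ F)
  (e⊣φ : ∀ {G F} → U F → e F ⊆ G ⇔ F ⊆ φ G)
  where

  φ∘e≡id : ∀ {F} → U F → φ (e F) ≡ F
  φ∘e≡id uF = ⊆-antisym (to (φ⊣e uF) ⊆-refl) (to (e⊣φ uF) ⊆-refl)

  e∘φ≡id : ∀ {G} → U (φ G) → G ≡ e (φ G)
  e∘φ≡id uφG = ⊆-antisym (from (φ⊣e uφG) ⊆-refl) (from (e⊣φ uφG) ⊆-refl)

  e-⊆-⇔ : ∀ {F F′} → U F → U F′ → e F ⊆ e F′ ⇔ F ⊆ F′
  e-⊆-⇔ {F} {F′} uF uF′ = subst (λ H → e F ⊆ e F′ ⇔ F ⊆ H) (φ∘e≡id uF′) (e⊣φ uF)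

  module _ (P : FinPoset k) {𝓕 : Family m} (𝓕⊆U : ∀ {F} → F ∈ 𝓕 → U F) where

    reflectCopy : InducedCopy P (map e 𝓕) → InducedCopy P 𝓕
    reflectCopy (i , _ , i∈e𝓕 , order) = inducedCopy P i′ i′∈𝓕 order′
      where
      i′ : Fin k → Subset m
      i′ p = proj₁ (∈-map⁻ e (i∈e𝓕 p))
      i′∈𝓕 : ∀ p → i′ p ∈ 𝓕
      i′∈𝓕 p = proj₁ (proj₂ (∈-map⁻ e (i∈e𝓕 p)))
      i≡e∘i′ : ∀ p → i p ≡ e (i′ p)
      i≡e∘i′ p = proj₂ (proj₂ (∈-map⁻ e (i∈e𝓕 p)))
      order′ : ∀ p q → _≤P_ P p q ⇔ i′ p ⊆ i′ q
      order′ p q = ⇔.trans (order p q) (⇔.trans (⊆-⇔-cong (i≡e∘i′ p) (i≡e∘i′ q))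
                                                (e-⊆-⇔ (𝓕⊆U (i′∈𝓕 p)) (𝓕⊆U (i′∈𝓕 q))))

    extendCopy : ∀ {G} → InducedCopy P (φ G ∷ 𝓕) → InducedCopy P (G ∷ map e 𝓕)
    extendCopy {G} (i , _ , i∈ , order) =
      inducedCopy P (λ p → lift (i∈ p)) (λ p → lift-∈ (i∈ p))
                    (λ p q → ⇔.trans (order p q) (lift-⊆-⇔ (i∈ p) (i∈ q)))
      where
      lift : ∀ {B} → B ∈ φ G ∷ 𝓕 → Subset n
      lift     (here _)  = G
      lift {B} (there _) = e B
      lift-∈ : ∀ {B} (B∈ : B ∈ φ G ∷ 𝓕) → lift B∈ ∈ G ∷ map e 𝓕
      lift-∈ (here _)   = here refl
      lift-∈ (there B∈) = there (∈-map⁺ e B∈)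
      lift-⊆-⇔ : ∀ {B C} (B∈ : B ∈ φ G ∷ 𝓕) (C∈ : C ∈ φ G ∷ 𝓕) → B ⊆ C ⇔ lift B∈ ⊆ lift C∈
      lift-⊆-⇔ (here refl) (here refl) =
        mk⇔ {A = φ G ⊆ φ G} {B = G ⊆ G} (λ _ → ⊆-refl) (λ _ → ⊆-refl)
      lift-⊆-⇔ (here refl) (there C∈) = ⇔.sym (φ⊣e (𝓕⊆U C∈))
      lift-⊆-⇔ (there B∈) (here refl) = ⇔.sym (e⊣φ (𝓕⊆U B∈))
      lift-⊆-⇔ (there B∈) (there C∈) = ⇔.sym (e-⊆-⇔ (𝓕⊆U B∈) (𝓕⊆U C∈))

    saturating-map : Saturating P 𝓕 → Saturating P (map e 𝓕)
    saturating-map (noCopy , saturated) =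
      noCopy ∘ reflectCopy , λ G G∉ → extendCopy (saturated (φ G) (G∉ ∘ φG∈⇒G∈))
      where
      φG∈⇒G∈ : ∀ {G} → φ G ∈ 𝓕 → G ∈ map e 𝓕
      φG∈⇒G∈ {G} φG∈ = subst (_∈ map e 𝓕) (sym (e∘φ≡id (𝓕⊆U φG∈))) (∈-map⁺ e φG∈)

Agree : Fin m → Fin m → Subset m → Set
Agree x y F = lookup F x ≡ lookup F y

¬separated⇒agree : ∀ {𝓕 : Family m} {x y} → ¬ Separated 𝓕 x y → ∀ {F} → F ∈ 𝓕 → Agree x y F
¬separated⇒agree {x = x} {y} ¬sep {F} F∈ with lookup F x in Fx | lookup F y in Fy
... | true  | true  = refl
... | false | false = refl
... | true  | false = contradiction (F , F∈ , inj₁ (lookup⇒[]= x F Fx , ∉-lookup Fy)) ¬sep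
... | false | true  = contradiction (F , F∈ , inj₂ (∉-lookup Fx , lookup⇒[]= y F Fy)) ¬sep

duplicate : Fin m → Subset m → Subset (suc m)
duplicate x F = lookup F x ∷ F

duplicate-injective : ∀ {x : Fin m} {F F′} → duplicate x F ≡ duplicate x F′ → F ≡ F′
duplicate-injective = ∷-injectiveʳ

¬separated-duplicate : ∀ {𝓕 : Family m} {x y} →
  ¬ Separated 𝓕 x y → ¬ Separated (map (duplicate x) 𝓕) (suc x) (suc y)
¬separated-duplicate {x = x} ¬sep (_ , F′∈ , separates) with ∈-map⁻ (duplicate x) F′∈
... | F , F∈ , refl = ¬sep (F , F∈ , Sum.map (Product.map drop-there (_∘ Vec.there))
                                              (Product.map (_∘ Vec.there) drop-there) separates)

module Merge (x y : Fin m) (x≢y : x ≢ y) where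

  blockAny blockAll : Subset (suc m) → Bool
  blockAny (b ∷ G) = b ∨ (lookup G x ∨ lookup G y)
  blockAll (b ∷ G) = b ∧ (lookup G x ∧ lookup G y)

  merge : Subset (suc m) → Subset m
  merge (b ∷ G) = G [ x ]≔ blockAny (b ∷ G) [ y ]≔ blockAll (b ∷ G)

  data Position : Fin m → Set where
    at-x : Position x
    at-y : Position y
    elsewhere : ∀ {j} → j ≢ x → j ≢ y → Position j

  position : ∀ j → Position j
  position j with j ≟ x | j ≟ y
  ... | yes refl | _        = at-x
  ... | no _     | yes refl = at-y
  ... | no j≢x   | no j≢y   = elsewhere j≢x j≢y

  merge-x : ∀ G → lookup (merge G) x ≡ blockAny G
  merge-x (b ∷ G) =
    trans (lookup∘update′ x≢y (G [ x ]≔ blockAny (b ∷ G)) _) (lookup∘update x G _)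

  merge-y : ∀ G → lookup (merge G) y ≡ blockAll G
  merge-y (b ∷ G) = lookup∘update y (G [ x ]≔ blockAny (b ∷ G)) _

  merge-elsewhere : ∀ {b G j} → j ≢ x → j ≢ y → lookup (merge (b ∷ G)) j ≡ lookup G j
  merge-elsewhere {b} {G} j≢x j≢y =
    trans (lookup∘update′ j≢y (G [ x ]≔ blockAny (b ∷ G)) _) (lookup∘update′ j≢x G _)

  module Block (b : Bool) (G : Subset m) where

    anyˡ : b ≤ᵇ blockAny (b ∷ G)
    anyˡ = ≤-∨ˡ b _

    any-x : lookup G x ≤ᵇ blockAny (b ∷ G)
    any-x = ≤ᵇ-trans (≤-∨ˡ _ (lookup G y)) (≤-∨ʳ b _)

    any-y : lookup G y ≤ᵇ blockAny (b ∷ G)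
    any-y = ≤ᵇ-trans (≤-∨ʳ (lookup G x) _) (≤-∨ʳ b _)

    any-least : ∀ {c} → b ≤ᵇ c → lookup G x ≤ᵇ c → lookup G y ≤ᵇ c → blockAny (b ∷ G) ≤ᵇ c
    any-least b≤c Gx≤c Gy≤c = ∨-least b≤c (∨-least Gx≤c Gy≤c)

    allˡ : blockAll (b ∷ G) ≤ᵇ b
    allˡ = ∧-≤ˡ b _

    all-x : blockAll (b ∷ G) ≤ᵇ lookup G x
    all-x = ≤ᵇ-trans (∧-≤ʳ b _) (∧-≤ˡ _ (lookup G y))

    all-y : blockAll (b ∷ G) ≤ᵇ lookup G y
    all-y = ≤ᵇ-trans (∧-≤ʳ b _) (∧-≤ʳ (lookup G x) _)

    all-greatest : ∀ {c} → c ≤ᵇ b → c ≤ᵇ lookup G x → c ≤ᵇ lookup G y → c ≤ᵇ blockAll (b ∷ G)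
    all-greatest c≤b c≤Gx c≤Gy = ∧-greatest c≤b (∧-greatest c≤Gx c≤Gy)

  module _ {b : Bool} {G : Subset m} {F : Subset m} (agree : Agree x y F) where
    open Block b G

    any≤Fx : merge (b ∷ G) ⊑ F → blockAny (b ∷ G) ≤ᵇ lookup F x
    any≤Fx k = subst (_≤ᵇ lookup F x) (merge-x (b ∷ G)) (k x)

    Fx≤all : F ⊑ merge (b ∷ G) → lookup F x ≤ᵇ blockAll (b ∷ G)
    Fx≤all k = ≤ᵇ-trans (≤ᵇ-reflexive agree) (subst (lookup F y ≤ᵇ_) (merge-y (b ∷ G)) (k y))

    ⊑-duplicate⇒merge-⊑ : b ∷ G ⊑ duplicate x F → merge (b ∷ G) ⊑ F
    ⊑-duplicate⇒merge-⊑ h j with position j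
    ... | at-x rewrite merge-x (b ∷ G) =
      any-least (h zero) (h (suc x)) (≤ᵇ-trans (h (suc y)) (≤ᵇ-reflexive (sym agree)))
    ... | at-y rewrite merge-y (b ∷ G) = ≤ᵇ-trans allˡ (≤ᵇ-trans (h zero) (≤ᵇ-reflexive agree))
    ... | elsewhere j≢x j≢y rewrite merge-elsewhere {b} {G} j≢x j≢y = h (suc j)

    merge-⊑⇒⊑-duplicate : merge (b ∷ G) ⊑ F → b ∷ G ⊑ duplicate x F
    merge-⊑⇒⊑-duplicate k zero = ≤ᵇ-trans anyˡ (any≤Fx k)
    merge-⊑⇒⊑-duplicate k (suc j) with position j
    ... | at-x = ≤ᵇ-trans any-x (any≤Fx k)
    ... | at-y = ≤ᵇ-trans any-y (≤ᵇ-trans (any≤Fx k) (≤ᵇ-reflexive agree))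
    ... | elsewhere j≢x j≢y = subst (_≤ᵇ lookup F j) (merge-elsewhere {b} {G} j≢x j≢y) (k j)

    ⊑-merge⇒duplicate-⊑ : F ⊑ merge (b ∷ G) → duplicate x F ⊑ b ∷ G
    ⊑-merge⇒duplicate-⊑ k zero = ≤ᵇ-trans (Fx≤all k) allˡ
    ⊑-merge⇒duplicate-⊑ k (suc j) with position j
    ... | at-x = ≤ᵇ-trans (Fx≤all k) all-x
    ... | at-y = ≤ᵇ-trans (≤ᵇ-reflexive (sym agree)) (≤ᵇ-trans (Fx≤all k) all-y)
    ... | elsewhere j≢x j≢y = subst (lookup F j ≤ᵇ_) (merge-elsewhere {b} {G} j≢x j≢y) (k j)

    duplicate-⊑⇒⊑-merge : duplicate x F ⊑ b ∷ G → F ⊑ merge (b ∷ G)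
    duplicate-⊑⇒⊑-merge h j with position j
    ... | at-x rewrite merge-x (b ∷ G) = ≤ᵇ-trans (h zero) anyˡ
    ... | at-y rewrite merge-y (b ∷ G) | sym agree = all-greatest (h zero) (h (suc x))
      (≤ᵇ-trans (≤ᵇ-reflexive agree) (h (suc y)))
    ... | elsewhere j≢x j≢y rewrite merge-elsewhere {b} {G} j≢x j≢y = h (suc j)

  merge⊣duplicate : ∀ {G F} → Agree x y F → G ⊆ duplicate x F ⇔ merge G ⊆ F
  merge⊣duplicate {_ ∷ _} agree =
    ⊑-⇔⇒⊆-⇔ (mk⇔ (⊑-duplicate⇒merge-⊑ agree) (merge-⊑⇒⊑-duplicate agree))

  duplicate⊣merge : ∀ {G F} → Agree x y F → duplicate x F ⊆ G ⇔ F ⊆ merge G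
  duplicate⊣merge {_ ∷ _} agree =
    ⊑-⇔⇒⊆-⇔ (mk⇔ (duplicate-⊑⇒⊑-merge agree) (⊑-merge⇒duplicate-⊑ agree))

SaturatingNonSeparating : FinPoset k → ℕ → ℕ → Set
SaturatingNonSeparating P n c =
  ∃ λ (𝒢 : Family n) → Unique 𝒢 × Saturating P 𝒢 × NotSeparating 𝒢 × length 𝒢 ≡ c

module _ {P : FinPoset k} {c : ℕ} where

  grow : SaturatingNonSeparating P m c → SaturatingNonSeparating P (suc m) c
  grow (𝓕 , unique , saturating , (x , y , x≢y , ¬sep) , length≡c) =
    map (duplicate x) 𝓕 ,
    Unique.map⁺ duplicate-injective unique ,
    saturating-map P (¬separated⇒agree ¬sep) saturating ,
    (suc x , suc y , x≢y ∘ suc-injective , ¬separated-duplicate ¬sep) ,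
    trans (length-map (duplicate x) 𝓕) length≡c
    where
    open Merge x y x≢y
    open AdjointTransfer (Agree x y) (duplicate x) merge merge⊣duplicate duplicate⊣merge

  grow-≤′ : m ≤′ n → SaturatingNonSeparating P m c → SaturatingNonSeparating P n c
  grow-≤′ (≤′-reflexive refl) 𝓕 = 𝓕
  grow-≤′ (≤′-step m≤′n)      𝓕 = grow (grow-≤′ m≤′n 𝓕)

corollary15 : ∀ {k} (P : FinPoset k) (m : ℕ) (𝓕 : Family m) →
    Unique 𝓕 → Saturating P 𝓕 → NotSeparating 𝓕 →
    ∀ (n : ℕ) → m ≤ n → SatStar≤ n P (length 𝓕)
corollary15 P m 𝓕 unique saturating notSeparating n m≤n
  with grow-≤′ {P = P} (≤⇒≤′ m≤n) (𝓕 , unique , saturating , notSeparating , refl)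
... | 𝒢 , unique′ , saturating′ , _ , length≡ = 𝒢 , unique′ , saturating′ , ≤-reflexive length≡
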